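{- Let $G$ be a graph of order $n\geq 3$. Then $sdiam_{n-1}(G)=n-2$ if and only if $G$ is $2$-connected.
   Context: All graphs are finite, simple and undirected. For $S\subseteq V(G)$ with $|S|\geq 2$, the Steiner distance $d_G(S)$ is the minimum number of edges of a tree in $G$ whose vertex set contains $S$ ($\infty$ if none exists), and $sdiam_k(G)$ is the maximum of $d_G(S)$ over all $S\subseteq V(G)$ with $|S|=k$ (defined for $2\leq k\leq n$). -}

module Defs where

open import Data.Nat using (ℕ; zero; suc; _+_; _<_; _≤_; _<ᵇ_)
open import Data.Bool using (Bool; true; false; _∧_; if_then_else_)
open import Data.Fin using (Fin; toℕ)
open import Data.Fin.Subset using (Subset; _∈_; _∉_; ∣_∣)
open import Data.List using (List; map; allFin)
open import Data.Nat.ListAction using (sum)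
open import Data.Product using (_×_; Σ; ∃; ∃-syntax)
open import Relation.Binary.PropositionalEquality using (_≡_)

record Graph (n : ℕ) : Set where
  field
    adj    : Fin n → Fin n → Bool
    adj-sym    : ∀ i j → adj i j ≡ adj j i
    adj-irrefl : ∀ i → adj i i ≡ false
open Graph public

data Walk {n : ℕ} (P : Fin n → Set) (R : Fin n → Fin n → Set) : Fin n → Fin n → Set where
  here : ∀ {u} → P u → Walk P R u u
  step : ∀ {u w v} → P u → R u w → Walk P R w v → Walk P R u v

-- Number of (unordered) edges of a symmetric Bool-valued edge relation:
-- the number of pairs (i , j) with toℕ i < toℕ j and F i j = true.
edgeCount : {n : ℕ} → (Fin n → Fin n → Bool) → ℕ
edgeCount {n} F =
  sum (map (λ i → sum (map (λ j → if (toℕ i <ᵇ toℕ j) ∧ F i j then 1 else 0)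
                           (allFin n)))
           (allFin n))

record Tree {n : ℕ} (G : Graph n) : Set where
  field
    verts      : Subset n
    edges      : Fin n → Fin n → Bool
    edges-sym  : ∀ i j → edges i j ≡ edges j i
    edges-sub  : ∀ i j → edges i j ≡ true → (adj G i j ≡ true) × (i ∈ verts) × (j ∈ verts)
    connected  : ∀ u v → u ∈ verts → v ∈ verts →
                 Walk (λ w → w ∈ verts) (λ a b → edges a b ≡ true) u v
    tree-count : edgeCount edges + 1 ≡ ∣ verts ∣
open Tree public

size : {n : ℕ} {G : Graph n} → Tree G → ℕ
size T = edgeCount (edges T)

Contains : {n : ℕ} {G : Graph n} → Tree G → Subset n → Set
Contains T S = ∀ v → v ∈ S → v ∈ verts T

-- d_G(S) = d : some tree containing S has d edges and every such tree has ≥ d edges.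
-- (If no tree contains S, d_G(S) = ∞ and HasSteinerDist G S d holds for no d.)
HasSteinerDist : {n : ℕ} → Graph n → Subset n → ℕ → Set
HasSteinerDist G S d =
  (Σ (Tree G) λ T → Contains T S × size T ≡ d) ×
  (∀ (T : Tree G) → Contains T S → d ≤ size T)

HasSdiam : {n : ℕ} → Graph n → ℕ → ℕ → Set
HasSdiam {n} G k m =
  (∀ (S : Subset n) → ∣ S ∣ ≡ k → ∃[ d ] (HasSteinerDist G S d × d ≤ m)) ×
  (∃[ S ] (∣ S ∣ ≡ k × HasSteinerDist G S m))

ConnectedAvoiding : {n : ℕ} → Graph n → Subset n → Set
ConnectedAvoiding {n} G X =
  ∀ u v → u ∉ X → v ∉ X → Walk (λ w → w ∉ X) (λ a b → adj G a b ≡ true) u v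

KConnected : {n : ℕ} → ℕ → Graph n → Set
KConnected {n} k G = (k < n) × (∀ (X : Subset n) → ∣ X ∣ < k → ConnectedAvoiding G X)

-- A tree has one vertex more
-- than it has edges (tree-order), so a tree containing S has at least |S| - 1
-- edges, and if it has no more, its vertex set is exactly S and G[S] is
-- connected (tight-tree⇒connected).  Conversely a connected G[S] has a
-- spanning tree, grown from one vertex by repeatedly adding an edge leaving
-- the current tree (spanningTree); so d_G(S) = |S| - 1 whenever G[S] is
-- connected (connected⇒steinerDist).
--
-- An (n-1)-subset of V(G) is the complement of one vertex v, so
-- sdiam_{n-1}(G) = n-2 says exactly that every G - v is connected
-- (sdiam⇔vertex-deleted-connected); for n ≥ 3 this is 2-connectivity
-- (2-connected⇔vertex-deleted-connected), and the theorem follows.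
module Submission where

open import Defs
open import Data.Nat using (ℕ; zero; suc; _+_; _≤_; _<_; _∸_; _<ᵇ_; s≤s; z≤n)
open import Data.Nat.Properties
  using (≤-refl; ≤-reflexive; m≤m+n; +-suc; +-comm; <ᵇ⇒<; <⇒<ᵇ; <-asym; <-cmp; ≤-pred; <⇒≱;
         suc-injective)
open import Data.Bool using (Bool; true; false; _∧_; _∨_; if_then_else_; T)
open import Data.Bool.Properties using (∨-identityʳ; ∨-zeroʳ; ∧-zeroʳ; T-≡)
open import Data.Fin using (Fin; toℕ; zero; suc)
open import Data.Fin.Properties using (_≟_; any?; toℕ-injective)
import Data.Fin.Properties as Fin
open import Data.Fin.Subset
  using (Subset; _∈_; _∉_; ∣_∣; _∪_; ⁅_⁆; ∁; _⊆_; ⊤; ⊥; inside; outside)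
open import Data.Fin.Subset.Properties
  using (_∈?_; ∪-identityʳ; p⊂q⇒∣p∣<∣q∣; p⊆q⇒∣p∣≤∣q∣; ⊆-antisym; x∈⁅x⁆; x∈⁅y⁆⇒x≡y;
         x≢y⇒x∉⁅y⁆; ∣⁅x⁆∣≡1; ∣∁p∣≡n∸∣p∣; x∈∁p⇒x∉p; x∉p⇒x∈∁p; x∈p∪q⁻; x∈p∪q⁺;
         ∣⊤∣≡n; ∈⊤; nonempty?; ∉⊥; ∣⊥∣≡0)
open import Data.List using (allFin; tabulate)
open import Data.List.Properties using (map-tabulate; map-cong; tabulate-cong)
open import Data.Nat.ListAction using (sum)
open import Data.Product using (_×_; Σ; _,_; proj₁; proj₂)
open import Data.Sum using (_⊎_; inj₁; inj₂; [_,_])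
import Data.Sum as Sum
open import Data.Unit using (tt)
open import Data.Vec using (_∷_)
import Data.Vec as Vec
open import Function using (_∘_; id)
open import Function.Bundles using (_⇔_; mk⇔; Equivalence)
open import Function.Properties.Equivalence
  using () renaming (trans to ⇔-trans; sym to ⇔-sym)
open import Relation.Nullary using (¬_; Dec; yes; no; does; contradiction; ¬?)
open import Relation.Nullary.Decidable
  using (decidable-stable; _×-dec_; _⊎-dec_; dec-true; dec-false; does-⇔)
open import Relation.Binary using (tri<; tri≈; tri>)
open import Relation.Binary.PropositionalEquality
  using (_≡_; _≢_; refl; sym; trans; cong; cong₂; subst; subst₂; module ≡-Reasoning)
open ≡-Reasoning

private
  variable
    n : ℕ

sum-tabulate-bump : (f g : Fin n → ℕ) (k : Fin n) →
                    (∀ i → i ≢ k → g i ≡ f i) → g k ≡ suc (f k) →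
                    sum (tabulate g) ≡ suc (sum (tabulate f))
sum-tabulate-bump f g zero same gk =
  cong₂ _+_ gk (cong sum (tabulate-cong (λ i → same (suc i) λ ())))
sum-tabulate-bump f g (suc k) same gk = begin
  g zero + sum (tabulate (g ∘ suc))        ≡⟨ cong₂ _+_ (same zero λ ()) rest ⟩
  f zero + suc (sum (tabulate (f ∘ suc)))  ≡⟨ +-suc (f zero) _ ⟩
  suc (sum (tabulate f))                   ∎
  where
  rest : sum (tabulate (g ∘ suc)) ≡ suc (sum (tabulate (f ∘ suc)))
  rest = sum-tabulate-bump (f ∘ suc) (g ∘ suc) k
           (λ i i≢k → same (suc i) (i≢k ∘ Fin.suc-injective)) gk

sum-tabulate-zero : (f : Fin n → ℕ) → (∀ i → f i ≡ 0) → sum (tabulate f) ≡ 0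
sum-tabulate-zero {zero}  f zeros = refl
sum-tabulate-zero {suc n} f zeros =
  cong₂ _+_ (zeros zero) (sum-tabulate-zero (f ∘ suc) (zeros ∘ suc))

edgeIndicator : (Fin n → Fin n → Bool) → Fin n → Fin n → ℕ
edgeIndicator F i j = if (toℕ i <ᵇ toℕ j) ∧ F i j then 1 else 0

edgeCount-tabulate : (F : Fin n → Fin n → Bool) →
                     edgeCount F ≡ sum (tabulate λ i → sum (tabulate (edgeIndicator F i)))
edgeCount-tabulate {n} F = cong sum (trans (map-tabulate id _)
  (tabulate-cong λ i → cong sum (map-tabulate {n = n} id (edgeIndicator F i))))

edgeCount-cong : (F F′ : Fin n → Fin n → Bool) → (∀ i j → F i j ≡ F′ i j) →
                 edgeCount F ≡ edgeCount F′
edgeCount-cong {n} F F′ F≗F′ =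
  cong sum (map-cong (λ i → cong sum (map-cong (λ j → indicator i j (F≗F′ i j)) (allFin n)))
                     (allFin n))
  where
  indicator : ∀ i j {b c} → b ≡ c →
              (if (toℕ i <ᵇ toℕ j) ∧ b then 1 else 0) ≡ (if (toℕ i <ᵇ toℕ j) ∧ c then 1 else 0)
  indicator i j = cong (λ b → if (toℕ i <ᵇ toℕ j) ∧ b then 1 else 0)

edgeCount-empty : edgeCount {n} (λ _ _ → false) ≡ 0
edgeCount-empty {n} = trans (edgeCount-tabulate {n} (λ _ _ → false))
  (sum-tabulate-zero {n} _ λ i →
     sum-tabulate-zero (edgeIndicator (λ _ _ → false) i) λ j →
       cong (λ b → if b then 1 else 0) (∧-zeroʳ (toℕ i <ᵇ toℕ j)))

edgeIndicator-descending : (H : Fin n → Fin n → Bool) {i j : Fin n} →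
                           toℕ j < toℕ i → edgeIndicator H i j ≡ 0
edgeIndicator-descending H {i} {j} j<i with toℕ i <ᵇ toℕ j in i<ᵇj
... | false = refl
... | true  = contradiction (<ᵇ⇒< _ _ (subst T (sym i<ᵇj) tt)) (<-asym j<i)

edgeCount-insert : (F F′ : Fin n → Fin n → Bool) {x y : Fin n} → toℕ x < toℕ y →
                   F x y ≡ false → F′ x y ≡ true →
                   (∀ i j → ¬ (i ≡ x × j ≡ y) → edgeIndicator F′ i j ≡ edgeIndicator F i j) →
                   edgeCount F′ ≡ suc (edgeCount F)
edgeCount-insert {n} F F′ {x} {y} x<y off on same = begin
  edgeCount F′                 ≡⟨ edgeCount-tabulate F′ ⟩
  sum (tabulate (row F′))      ≡⟨ sum-tabulate-bump (row F) (row F′) x otherRows rowX ⟩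
  suc (sum (tabulate (row F))) ≡⟨ cong suc (sym (edgeCount-tabulate F)) ⟩
  suc (edgeCount F)            ∎
  where
  row : (Fin n → Fin n → Bool) → Fin n → ℕ
  row H i = sum (tabulate (edgeIndicator H i))
  otherRows : ∀ i → i ≢ x → row F′ i ≡ row F i
  otherRows i i≢x = cong sum (tabulate-cong λ j → same i j (i≢x ∘ proj₁))
  pairXY : edgeIndicator F′ x y ≡ suc (edgeIndicator F x y)
  pairXY rewrite Equivalence.to T-≡ (<⇒<ᵇ x<y) | off | on = refl
  rowX : row F′ x ≡ suc (row F x)
  rowX = sum-tabulate-bump _ _ y (λ j j≢y → same x j (j≢y ∘ proj₂)) pairXY

Joins : Fin n → Fin n → Fin n → Fin n → Set
Joins a b i j = (i ≡ a × j ≡ b) ⊎ (i ≡ b × j ≡ a)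

joins? : (a b i j : Fin n) → Dec (Joins a b i j)
joins? a b i j = ((i ≟ a) ×-dec (j ≟ b)) ⊎-dec ((i ≟ b) ×-dec (j ≟ a))

Joins-flip : {a b i j : Fin n} → Joins a b i j → Joins a b j i
Joins-flip = [ (λ (p , q) → inj₂ (q , p)) , (λ (p , q) → inj₁ (q , p)) ]

addEdge : (Fin n → Fin n → Bool) → Fin n → Fin n → Fin n → Fin n → Bool
addEdge F a b i j = F i j ∨ does (joins? a b i j)

addEdge-off : (F : Fin n → Fin n → Bool) {a b i j : Fin n} →
              ¬ Joins a b i j → addEdge F a b i j ≡ F i j
addEdge-off F {a} {b} {i} {j} ¬J =
  trans (cong (F i j ∨_) (dec-false (joins? a b i j) ¬J)) (∨-identityʳ (F i j))

addEdge-on : (F : Fin n → Fin n → Bool) {a b i j : Fin n} →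
             Joins a b i j → addEdge F a b i j ≡ true
addEdge-on F {a} {b} {i} {j} J =
  trans (cong (F i j ∨_) (dec-true (joins? a b i j) J)) (∨-zeroʳ (F i j))

addEdge-keeps : (F : Fin n → Fin n → Bool) {a b i j : Fin n} →
                F i j ≡ true → addEdge F a b i j ≡ true
addEdge-keeps F {a} {b} {i} {j} Fij = cong (_∨ does (joins? a b i j)) Fij

addEdge-sym : (F : Fin n → Fin n → Bool) (a b : Fin n) → (∀ i j → F i j ≡ F j i) →
              ∀ i j → addEdge F a b i j ≡ addEdge F a b j i
addEdge-sym F a b F-sym i j =
  cong₂ _∨_ (F-sym i j) (does-⇔ (mk⇔ Joins-flip Joins-flip) (joins? a b i j) (joins? a b j i))

addEdge-swap : (F : Fin n → Fin n → Bool) (a b : Fin n) →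
               ∀ i j → addEdge F a b i j ≡ addEdge F b a i j
addEdge-swap F a b i j =
  cong (F i j ∨_) (does-⇔ (mk⇔ Sum.swap Sum.swap) (joins? a b i j) (joins? b a i j))

edgeCount-addEdge< : (F : Fin n → Fin n → Bool) {a b : Fin n} → toℕ a < toℕ b →
                     F a b ≡ false → edgeCount (addEdge F a b) ≡ suc (edgeCount F)
edgeCount-addEdge< F {a} {b} a<b off =
  edgeCount-insert F (addEdge F a b) a<b off (addEdge-on F (inj₁ (refl , refl))) same
  where
  -- apart from (a , b) only (b , a) changes, and descending pairs are not counted
  same : ∀ i j → ¬ (i ≡ a × j ≡ b) →
         edgeIndicator (addEdge F a b) i j ≡ edgeIndicator F i j
  same i j ¬ab with joins? a b i j
  ... | yes (inj₁ ab)            = contradiction ab ¬ab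
  ... | yes (inj₂ (refl , refl)) = trans (edgeIndicator-descending (addEdge F a b) a<b)
                                         (sym (edgeIndicator-descending F a<b))
  ... | no ¬J = cong (λ c → if (toℕ i <ᵇ toℕ j) ∧ c then 1 else 0) (addEdge-off F ¬J)

edgeCount-addEdge : (F : Fin n → Fin n → Bool) {a b : Fin n} → a ≢ b →
                    (∀ i j → F i j ≡ F j i) → F a b ≡ false →
                    edgeCount (addEdge F a b) ≡ suc (edgeCount F)
edgeCount-addEdge F {a} {b} a≢b F-sym off with <-cmp (toℕ a) (toℕ b)
... | tri< a<b _ _ = edgeCount-addEdge< F a<b off
... | tri≈ _ a≡b _ = contradiction (toℕ-injective a≡b) a≢b
... | tri> _ _ b<a = begin
  edgeCount (addEdge F a b) ≡⟨ edgeCount-cong _ _ (addEdge-swap F a b) ⟩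
  edgeCount (addEdge F b a) ≡⟨ edgeCount-addEdge< F b<a (trans (F-sym b a) off) ⟩
  suc (edgeCount F)         ∎

walk-map : {P P′ : Fin n → Set} {R R′ : Fin n → Fin n → Set} →
           (∀ {x} → P x → P′ x) → (∀ {x y} → R x y → R′ x y) →
           ∀ {u v} → Walk P R u v → Walk P′ R′ u v
walk-map f g (here p)          = here (f p)
walk-map f g (step p r rest)   = step (f p) (g r) (walk-map f g rest)

_++ʷ_ : {P : Fin n → Set} {R : Fin n → Fin n → Set} {u w v : Fin n} →
        Walk P R u w → Walk P R w v → Walk P R u v
here _        ++ʷ q = q
step p r rest ++ʷ q = step p r (rest ++ʷ q)

walk-start : {P : Fin n → Set} {R : Fin n → Fin n → Set} {u v : Fin n} →
             Walk P R u v → P u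
walk-start (here p)     = p
walk-start (step p _ _) = p

crossing-step : {P : Fin n → Set} {R : Fin n → Fin n → Set} (V : Subset n)
                {u w : Fin n} →
                Walk P R u w → u ∈ V → w ∉ V →
                Σ (Fin n) λ a → Σ (Fin n) λ b → a ∈ V × b ∉ V × P b × R a b
crossing-step V (here _) u∈V u∉V = contradiction u∈V u∉V
crossing-step V (step {w = x} _ r rest) u∈V w∉V with x ∈? V
... | yes x∈V = crossing-step V rest x∈V w∉V
... | no  x∉V = _ , x , u∈V , x∉V , walk-start rest , r

∣p∪⁅x⁆∣ : (p : Subset n) {x : Fin n} → x ∉ p → ∣ p ∪ ⁅ x ⁆ ∣ ≡ suc ∣ p ∣
∣p∪⁅x⁆∣ (outside ∷ p) {zero}  x∉p = cong suc (cong ∣_∣ (∪-identityʳ p))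
∣p∪⁅x⁆∣ (inside  ∷ p) {zero}  x∉p = contradiction Vec.here x∉p
∣p∪⁅x⁆∣ (outside ∷ p) {suc x} x∉p = ∣p∪⁅x⁆∣ p (x∉p ∘ Vec.there)
∣p∪⁅x⁆∣ (inside  ∷ p) {suc x} x∉p = cong suc (∣p∪⁅x⁆∣ p (x∉p ∘ Vec.there))

∣∁⁅x⁆∣ : (x : Fin n) → ∣ ∁ ⁅ x ⁆ ∣ ≡ n ∸ 1
∣∁⁅x⁆∣ {n} x = trans (∣∁p∣≡n∸∣p∣ ⁅ x ⁆) (cong (n ∸_) (∣⁅x⁆∣≡1 x))

⊆-or-missing : (p q : Subset n) → q ⊆ p ⊎ Σ (Fin n) λ x → x ∈ q × x ∉ p
⊆-or-missing p q with any? (λ x → (x ∈? q) ×-dec ¬? (x ∈? p))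
... | yes witness = inj₂ witness
... | no  none    =
  inj₁ λ {x} x∈q → decidable-stable (x ∈? p) (λ x∉p → none (x , x∈q , x∉p))

⊆-card-⊇ : {p q : Subset n} → p ⊆ q → ∣ q ∣ ≤ ∣ p ∣ → q ⊆ p
⊆-card-⊇ {p = p} {q} p⊆q q≤p with ⊆-or-missing p q
... | inj₁ q⊆p             = q⊆p
... | inj₂ (x , x∈q , x∉p) = contradiction q≤p (<⇒≱ (p⊂q⇒∣p∣<∣q∣ (p⊆q , x , x∈q , x∉p)))

missing-element : {p q : Subset n} → p ⊆ q → ∣ p ∣ < ∣ q ∣ →
                  Σ (Fin n) λ x → x ∈ q × x ∉ p
missing-element {p = p} {q} p⊆q p<q with ⊆-or-missing p q
... | inj₁ q⊆p = contradiction (p⊆q⇒∣p∣≤∣q∣ q⊆p) (<⇒≱ p<q)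
... | inj₂ x∈q∖p = x∈q∖p

inhabited : {S : Subset n} → 0 < ∣ S ∣ → Σ (Fin n) (_∈ S)
inhabited {n} {S} 0<∣S∣
  with missing-element {p = ⊥} (λ x∈⊥ → contradiction x∈⊥ ∉⊥)
                       (subst (_< ∣ S ∣) (sym (∣⊥∣≡0 n)) 0<∣S∣)
... | x , x∈S , _ = x , x∈S

co-singleton : (S : Subset (suc n)) → ∣ S ∣ ≡ n → Σ (Fin (suc n)) λ v → S ≡ ∁ ⁅ v ⁆
co-singleton {n} S ∣S∣≡n with missing-element (λ _ → ∈⊤)
                                (subst₂ _<_ (sym ∣S∣≡n) (sym (∣⊤∣≡n (suc n))) ≤-refl)
... | v , _ , v∉S = v , ⊆-antisym S⊆∁⁅v⁆ (⊆-card-⊇ S⊆∁⁅v⁆ (≤-reflexive ∣∁⁅v⁆∣≡∣S∣))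
  where
  S⊆∁⁅v⁆ : S ⊆ ∁ ⁅ v ⁆
  S⊆∁⁅v⁆ {x} x∈S = x∉p⇒x∈∁p (x≢y⇒x∉⁅y⁆ λ { refl → v∉S x∈S })
  ∣∁⁅v⁆∣≡∣S∣ : ∣ ∁ ⁅ v ⁆ ∣ ≡ ∣ S ∣
  ∣∁⁅v⁆∣≡∣S∣ = trans (∣∁⁅x⁆∣ v) (sym ∣S∣≡n)

⊆⁅x⁆ : {X : Subset n} {x : Fin n} → ∣ X ∣ ≤ 1 → x ∈ X → X ⊆ ⁅ x ⁆
⊆⁅x⁆ {x = x} ∣X∣≤1 x∈X =
  ⊆-card-⊇ (λ y∈⁅x⁆ → subst (_∈ _) (sym (x∈⁅y⁆⇒x≡y x y∈⁅x⁆)) x∈X)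
           (subst (_ ≤_) (sym (∣⁅x⁆∣≡1 x)) ∣X∣≤1)

tree-order : {G : Graph n} (T : Tree G) → suc (size T) ≡ ∣ verts T ∣
tree-order T = trans (+-comm 1 (size T)) (tree-count T)

tree-lower-bound : {G : Graph n} {S : Subset n} (T : Tree G) → Contains T S →
                   ∣ S ∣ ≤ suc (size T)
tree-lower-bound T S⊆T = subst (_ ≤_) (sym (tree-order T)) (p⊆q⇒∣p∣≤∣q∣ (S⊆T _))

singleTree : {G : Graph n} → Fin n → Tree G
singleTree {n} r = record
  { verts      = ⁅ r ⁆
  ; edges      = λ _ _ → false
  ; edges-sym  = λ _ _ → refl
  ; edges-sub  = λ _ _ ()
  ; connected  = λ u v u∈ v∈ →
                   subst₂ (Walk _ _) (sym (x∈⁅y⁆⇒x≡y r u∈)) (sym (x∈⁅y⁆⇒x≡y r v∈))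
                          (here (x∈⁅x⁆ r))
  ; tree-count = trans (cong (_+ 1) (edgeCount-empty {n})) (sym (∣⁅x⁆∣≡1 r))
  }

module Extension {G : Graph n} (T : Tree G) {a b : Fin n}
                 (a∈T : a ∈ verts T) (b∉T : b ∉ verts T) (ab : adj G a b ≡ true) where

  verts′ : Subset n
  verts′ = verts T ∪ ⁅ b ⁆

  edges′ : Fin n → Fin n → Bool
  edges′ = addEdge (edges T) a b

  old : ∀ {x} → x ∈ verts T → x ∈ verts′
  old x∈T = x∈p∪q⁺ (inj₁ x∈T)

  new : b ∈ verts′
  new = x∈p∪q⁺ (inj₂ (x∈⁅x⁆ b))

  edges′-sub : ∀ i j → edges′ i j ≡ true → (adj G i j ≡ true) × (i ∈ verts′) × (j ∈ verts′)
  edges′-sub i j ij∈T′ with joins? a b i j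
  ... | yes (inj₁ (refl , refl)) = ab , old a∈T , new
  ... | yes (inj₂ (refl , refl)) = trans (adj-sym G b a) ab , new , old a∈T
  ... | no ¬J =
    let adj-ij , i∈T , j∈T = edges-sub T i j (trans (sym (addEdge-off (edges T) ¬J)) ij∈T′)
    in  adj-ij , old i∈T , old j∈T

  private
    Walk′ : Fin n → Fin n → Set
    Walk′ = Walk (_∈ verts′) (λ x y → edges′ x y ≡ true)

    lift : ∀ {u v} → Walk (_∈ verts T) (λ x y → edges T x y ≡ true) u v → Walk′ u v
    lift = walk-map old (addEdge-keeps (edges T))

    toA : ∀ {x} → x ∈ verts′ → Walk′ x a
    toA {x} x∈T′ with x∈p∪q⁻ (verts T) ⁅ b ⁆ x∈T′
    ... | inj₁ x∈T = lift (connected T x a x∈T a∈T)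
    ... | inj₂ x∈⁅b⁆ with refl ← x∈⁅y⁆⇒x≡y b x∈⁅b⁆ =
      step new (addEdge-on (edges T) (inj₂ (refl , refl))) (here (old a∈T))

    fromA : ∀ {x} → x ∈ verts′ → Walk′ a x
    fromA {x} x∈T′ with x∈p∪q⁻ (verts T) ⁅ b ⁆ x∈T′
    ... | inj₁ x∈T = lift (connected T a x a∈T x∈T)
    ... | inj₂ x∈⁅b⁆ with refl ← x∈⁅y⁆⇒x≡y b x∈⁅b⁆ =
      step (old a∈T) (addEdge-on (edges T) (inj₁ (refl , refl))) (here new)

  connected′ : ∀ u v → u ∈ verts′ → v ∈ verts′ → Walk′ u v
  connected′ u v u∈T′ v∈T′ = toA u∈T′ ++ʷ fromA v∈T′

  -- {a , b} is not yet an edge of T, since b is not a vertex of T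
  ab-new : edges T a b ≡ false
  ab-new with edges T a b in ab∈T
  ... | false = refl
  ... | true  = contradiction (proj₂ (proj₂ (edges-sub T a b ab∈T))) b∉T

  tree-count′ : edgeCount edges′ + 1 ≡ ∣ verts′ ∣
  tree-count′ = begin
    edgeCount edges′ + 1          ≡⟨ cong (_+ 1) one-more-edge ⟩
    suc (edgeCount (edges T) + 1) ≡⟨ cong suc (tree-count T) ⟩
    suc ∣ verts T ∣               ≡⟨ sym (∣p∪⁅x⁆∣ (verts T) b∉T) ⟩
    ∣ verts′ ∣                    ∎
    where
    a≢b : a ≢ b
    a≢b refl = b∉T a∈T
    one-more-edge : edgeCount edges′ ≡ suc (edgeCount (edges T))
    one-more-edge = edgeCount-addEdge (edges T) a≢b (edges-sym T) ab-new

  extend : Tree G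
  extend = record
    { verts      = verts′
    ; edges      = edges′
    ; edges-sym  = addEdge-sym (edges T) a b (edges-sym T)
    ; edges-sub  = edges′-sub
    ; connected  = connected′
    ; tree-count = tree-count′
    }

InducedConnected : Graph n → Subset n → Set
InducedConnected G W = ∀ u v → u ∈ W → v ∈ W → Walk (_∈ W) (λ x y → adj G x y ≡ true) u v

tree-connected : {G : Graph n} (T : Tree G) → InducedConnected G (verts T)
tree-connected T u v u∈T v∈T =
  walk-map (λ x∈T → x∈T) (λ xy∈T → proj₁ (edges-sub T _ _ xy∈T)) (connected T u v u∈T v∈T)

-- Growing a tree inside a connected G[W]: while a vertex of W is missing, some
-- edge of G[W] leaves the tree, and attaching it gives a larger tree inside W.
-- The fuel bounds the number of vertices still to be added.
grow : {G : Graph n} {W : Subset n} → InducedConnected G W →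
       (fuel : ℕ) (T : Tree G) {r : Fin n} → r ∈ verts T → verts T ⊆ W →
       ∣ W ∣ ≤ fuel + ∣ verts T ∣ → Σ (Tree G) λ T′ → verts T′ ≡ W
grow conn zero T r∈T T⊆W ∣W∣≤ = T , ⊆-antisym T⊆W (⊆-card-⊇ T⊆W ∣W∣≤)
grow {W = W} conn (suc fuel) T {r} r∈T T⊆W ∣W∣≤ with ⊆-or-missing (verts T) W
... | inj₁ W⊆T = T , ⊆-antisym T⊆W W⊆T
... | inj₂ (w , w∈W , w∉T) with crossing-step (verts T) (conn r w (T⊆W r∈T) w∈W) r∈T w∉T
... | a , b , a∈T , b∉T , b∈W , ab = grow conn fuel extend (old r∈T) T′⊆W ∣W∣≤′
  where
  open Extension T a∈T b∉T ab
  T′⊆W : verts′ ⊆ W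
  T′⊆W x∈T′ = [ T⊆W , (λ x∈⁅b⁆ → subst (_∈ W) (sym (x∈⁅y⁆⇒x≡y b x∈⁅b⁆)) b∈W) ]
                (x∈p∪q⁻ (verts T) ⁅ b ⁆ x∈T′)
  ∣W∣≤′ : ∣ W ∣ ≤ fuel + ∣ verts′ ∣
  ∣W∣≤′ = subst (∣ W ∣ ≤_) (trans (sym (+-suc fuel _)) (cong (fuel +_) (sym one-more-vertex)))
                 ∣W∣≤
    where
    one-more-vertex : ∣ verts′ ∣ ≡ suc ∣ verts T ∣
    one-more-vertex = ∣p∪⁅x⁆∣ (verts T) b∉T

spanningTree : {G : Graph n} {W : Subset n} {r : Fin n} → InducedConnected G W → r ∈ W →
               Σ (Tree G) λ T → verts T ≡ W
spanningTree {W = W} {r} conn r∈W =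
  grow conn ∣ W ∣ (singleTree r) (x∈⁅x⁆ r) ⁅r⁆⊆W (m≤m+n ∣ W ∣ ∣ ⁅ r ⁆ ∣)
  where
  ⁅r⁆⊆W : ⁅ r ⁆ ⊆ W
  ⁅r⁆⊆W x∈⁅r⁆ = subst (_∈ W) (sym (x∈⁅y⁆⇒x≡y r x∈⁅r⁆)) r∈W

-- If G[S] is connected then d_G(S) = ∣ S ∣ - 1: a spanning tree of G[S] attains
-- the lower bound of tree-lower-bound.
connected⇒steinerDist : {G : Graph n} {S : Subset n} {d : ℕ} →
                        InducedConnected G S → ∣ S ∣ ≡ suc d → HasSteinerDist G S d
connected⇒steinerDist {S = S} {d} conn ∣S∣≡1+d
  with _ , r∈S ← inhabited (subst (0 <_) (sym ∣S∣≡1+d) (s≤s z≤n))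
  with T , T≡S ← spanningTree conn r∈S
  = (T , S⊆T , size≡d) , minimal
  where
  S⊆T : Contains T S
  S⊆T x x∈S = subst (x ∈_) (sym T≡S) x∈S
  size≡d : size T ≡ d
  size≡d = suc-injective (trans (tree-order T) (trans (cong ∣_∣ T≡S) ∣S∣≡1+d))
  minimal : ∀ T′ → Contains T′ S → d ≤ size T′
  minimal T′ S⊆T′ = ≤-pred (subst (_≤ suc (size T′)) ∣S∣≡1+d (tree-lower-bound T′ S⊆T′))

-- Conversely, a tree containing S with only ∣ S ∣ - 1 edges spans exactly S,
-- so G[S] is connected.
tight-tree⇒connected : {G : Graph n} {S : Subset n} (T : Tree G) → Contains T S →
                       suc (size T) ≤ ∣ S ∣ → InducedConnected G S
tight-tree⇒connected {G = G} T S⊆T small = subst (InducedConnected G) T≡S (tree-connected T)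
  where
  T≡S : verts T ≡ _
  T≡S = ⊆-antisym (⊆-card-⊇ (S⊆T _) (subst (_≤ _) (tree-order T) small)) (S⊆T _)

VertexDeletedConnected : Graph n → Set
VertexDeletedConnected {n} G = ∀ (v : Fin n) → InducedConnected G (∁ ⁅ v ⁆)

-- For a graph of order k + 2, sdiam_{k+1}(G) = k says exactly that every
-- G - v is connected: the (k+1)-sets are the complements of single vertices.
sdiam⇔vertex-deleted-connected : {k : ℕ} (G : Graph (suc (suc k))) →
                                 HasSdiam G (suc k) k ⇔ VertexDeletedConnected G
sdiam⇔vertex-deleted-connected {k} G = mk⇔ to from
  where
  to : HasSdiam G (suc k) k → VertexDeletedConnected G
  to (bounded , _) v with bounded (∁ ⁅ v ⁆) (∣∁⁅x⁆∣ v)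
  ... | d , ((T , S⊆T , size≡d) , _) , d≤k =
    tight-tree⇒connected T S⊆T (subst (_ ≤_) (sym (∣∁⁅x⁆∣ v)) (s≤s (subst (_≤ k) (sym size≡d) d≤k)))

  from : VertexDeletedConnected G → HasSdiam G (suc k) k
  from conn = (λ S ∣S∣≡1+k → k , steiner S ∣S∣≡1+k , ≤-refl)
            , (∁ ⁅ zero ⁆ , ∣∁⁅x⁆∣ zero , steiner _ (∣∁⁅x⁆∣ zero))
    where
    steiner : ∀ S → ∣ S ∣ ≡ suc k → HasSteinerDist G S k
    steiner S ∣S∣≡1+k with v , refl ← co-singleton S ∣S∣≡1+k =
      connected⇒steinerDist (conn v) ∣S∣≡1+k

avoiding⇔complement-connected : {G : Graph n} {X : Subset n} →
                                ConnectedAvoiding G X ⇔ InducedConnected G (∁ X)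
avoiding⇔complement-connected = mk⇔
  (λ avoid u v u∈ v∈ → walk-map x∉p⇒x∈∁p id (avoid u v (x∈∁p⇒x∉p u∈) (x∈∁p⇒x∉p v∈)))
  (λ conn u v u∉ v∉ → walk-map x∈∁p⇒x∉p id (conn u v (x∉p⇒x∈∁p u∉) (x∉p⇒x∈∁p v∉)))

third-vertex : {m : ℕ} (u w : Fin (suc (suc (suc m)))) → Σ (Fin _) λ v → u ≢ v × w ≢ v
third-vertex zero          zero          = suc zero       , (λ ()) , (λ ())
third-vertex zero          (suc zero)    = suc (suc zero) , (λ ()) , (λ ())
third-vertex zero          (suc (suc _)) = suc zero       , (λ ()) , (λ ())
third-vertex (suc zero)    zero          = suc (suc zero) , (λ ()) , (λ ())
third-vertex (suc zero)    (suc _)       = zero           , (λ ()) , (λ ())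
third-vertex (suc (suc _)) zero          = suc zero       , (λ ()) , (λ ())
third-vertex (suc (suc _)) (suc _)       = zero           , (λ ()) , (λ ())

point-covering : {m : ℕ} {X : Subset (suc (suc (suc m)))} {u w : Fin _} →
                 ∣ X ∣ ≤ 1 → u ∉ X → w ∉ X → Σ (Fin _) λ v → u ≢ v × w ≢ v × X ⊆ ⁅ v ⁆
point-covering {X = X} {u} {w} ∣X∣≤1 u∉X w∉X with nonempty? X
... | yes (v , v∈X) = v , (λ { refl → u∉X v∈X }) , (λ { refl → w∉X v∈X }) , ⊆⁅x⁆ ∣X∣≤1 v∈X
... | no  empty     with v , u≢v , w≢v ← third-vertex u w =
  v , u≢v , w≢v , λ {x} x∈X → contradiction (x , x∈X) empty

-- For order ≥ 3, G is 2-connected iff every G - v is connected: a set X of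
-- fewer than two vertices avoided by u and w is inside some ⁅ v ⁆ avoided too.
2-connected⇔vertex-deleted-connected : {m : ℕ} (G : Graph (suc (suc (suc m)))) →
                                       KConnected 2 G ⇔ VertexDeletedConnected G
2-connected⇔vertex-deleted-connected G = mk⇔ to from
  where
  to : KConnected 2 G → VertexDeletedConnected G
  to (_ , cut) v = Equivalence.to (avoiding⇔complement-connected {G = G})
                     (cut ⁅ v ⁆ (subst (_< 2) (sym (∣⁅x⁆∣≡1 v)) ≤-refl))

  from : VertexDeletedConnected G → KConnected 2 G
  from conn = s≤s (s≤s (s≤s z≤n)) , avoid
    where
    avoid : ∀ X → ∣ X ∣ < 2 → ConnectedAvoiding G X
    avoid X ∣X∣<2 u w u∉X w∉X
      with v , u≢v , w≢v , X⊆⁅v⁆ ← point-covering (≤-pred ∣X∣<2) u∉X w∉X =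
      walk-map (λ x∉⁅v⁆ x∈X → x∉⁅v⁆ (X⊆⁅v⁆ x∈X)) id
        (Equivalence.from (avoiding⇔complement-connected {G = G}) (conn v) u w
          (x≢y⇒x∉⁅y⁆ u≢v) (x≢y⇒x∉⁅y⁆ w≢v))

-- The theorem: for n = m + 3, both sides say that every G - v is connected.
lemma5 : (n : ℕ) → 3 ≤ n → (G : Graph n) →
    HasSdiam G (n ∸ 1) (n ∸ 2) ⇔ KConnected 2 G
lemma5 (suc zero)          (s≤s ())       G
lemma5 (suc (suc zero))    (s≤s (s≤s ())) G
lemma5 (suc (suc (suc m))) _ G =
  ⇔-trans (sdiam⇔vertex-deleted-connected G) (⇔-sym (2-connected⇔vertex-deleted-connected G))
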